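{- Let $Q$ be finite with rank function $\rho$ and maximal rank $m$, with types, models and type interpretation as in the context, and let $k\le m$. For $S\subseteq\mathcal{T}^k_{A\to B}$ and $T\subseteq\mathcal{T}^k_A$: $[\![S(T)]\!]^k=[\![S]\!]^k([\![T]\!]^k)$.
   Context: $Q_k=\{q:\rho(q)=k\}$, $Q_{\le k}=\{q:\rho(q)\le k\}$. Intersection types: $\tau^k_o=Q_k$, $\tau^k_{A\to B}=\{T\to s: T\subseteq\mathcal{T}^k_A, s\in\tau^k_B\}$, $\mathcal{T}^k_A=\bigcup_{l\le k}\tau^l_A$. Subsumption: least relations with $S\sqsubseteq_o T$ if $S\subseteq T\subseteq Q$; $s\sqsubseteq_o t$ if $s=t$; $S\sqsubseteq_A T$ if every $s\in S$ has $t\in T$ with $s\sqsubseteq_A t$; $S\to s\sqsubseteq T\to t$ if $T\sqsubseteq S$ and $s\sqsubseteq t$. Type application: $S(T)=\{t:(U\to t)\in S\text{ and }U\sqsubseteq T\}$. Models: $\mathcal{D}^0_o=\mathcal{P}(Q_0)$, $\mathcal{D}^0_{A\to B}$ = monotone maps; for $k>0$: $\mathcal{D}^k_o=\mathcal{P}(Q_{\le k})$, $\mathcal{L}^k_o=\{(R,P): R=P\cap Q_{\le k-1}\}$, $\mathcal{L}^k_{A\to B}=\{(f_1,f_2): f_1\in\mathcal{D}^{k-1}_{A\to B}$, $f_2$ monotone $\mathcal{D}^k_A\to\mathcal{D}^k_B$, $(f_1(g_1),f_2(g_2))\in\mathcal{L}^k_B$ whenever $(g_1,g_2)\in\mathcal{L}^k_A\}$,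 $\mathcal{D}^k_{A\to B}=\{f_2:\exists f_1,(f_1,f_2)\in\mathcal{L}^k_{A\to B}\}$; order inclusion/pointwise; $\bot^k_B$ least element. Step function: $(d\Rightarrow e)(h)=e$ if $d\le h$, else $\bot^k_B$. $[\![q]\!]^k=\{q\}$ if $\rho(q)\le k$, else $\emptyset$; $[\![S]\!]^k=\bigvee\{[\![t]\!]^k:t\in S\}$; $[\![T\to s]\!]^k=[\![T]\!]^k\Rightarrow[\![s]\!]^k$. -}

module Defs where

open import Level using (0ℓ; Lift) renaming (suc to lsuc)
open import Data.Nat using (ℕ; zero; suc; _≤_; _≤ᵇ_; _⊔_)
open import Data.Fin using (Fin)
open import Data.List using (List; []; _∷_; foldr; map; allFin)
open import Data.List.Membership.Propositional using (_∈_)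
open import Data.List.Relation.Unary.All using (All)
import Data.Product
open import Data.Product using (Σ; Σ-syntax; ∃-syntax; _×_; _,_)
open import Data.Sum using (_⊎_)
open import Data.Empty using (⊥)
open import Data.Bool using (if_then_else_)
open import Function.Bundles using (_⇔_)
open import Relation.Nullary using (does)
open import Relation.Binary.PropositionalEquality using (_≡_)
open import Axiom.ExcludedMiddle using (ExcludedMiddle)

infixr 5 _⇒_
data Ty : Set where
  o   : Ty
  _⇒_ : Ty → Ty → Ty

maxRank : ∀ {n} → (Fin n → ℕ) → ℕ
maxRank {n} ρ = foldr _⊔_ 0 (map ρ (allFin n))

-- Raw intersection types (syntax).  Finite sets of intersection types
-- occurring inside arrow types are lists; T → s is  arr T s .

data ITy (n : ℕ) : Ty → Set where
  base : Fin n → ITy n o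
  arr  : ∀ {A B} → List (ITy n A) → ITy n B → ITy n (A ⇒ B)

TySet : ℕ → Ty → Set₁
TySet n A = ITy n A → Set

⟪_⟫ : ∀ {n A} → List (ITy n A) → TySet n A
⟪ T ⟫ t = t ∈ T

module Types {n : ℕ} (ρ : Fin n → ℕ) where

  mutual
    Inτ : ℕ → (A : Ty) → ITy n A → Set
    Inτ k o (base q) = ρ q ≡ k
    Inτ k (A ⇒ B) (arr T s) = All (In𝒯 k A) T × Inτ k B s

    In𝒯 : ℕ → (A : Ty) → ITy n A → Set
    In𝒯 k A t = Σ[ l ∈ ℕ ] (l ≤ k × Inτ l A t)

  mutual
    TySub : (A : Ty) → ITy n A → ITy n A → Set
    TySub o s t = s ≡ t
    TySub (A ⇒ B) (arr S s) (arr T t) = SetSub A ⟪ T ⟫ ⟪ S ⟫ × TySub B s t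

    SetSub : (A : Ty) → TySet n A → TySet n A → Set
    SetSub o S T = ∀ q → S q → T q
    SetSub (A ⇒ B) S T = ∀ s → S s → Σ[ t ∈ ITy n (A ⇒ B) ] (T t × TySub (A ⇒ B) s t)

  tyApp : ∀ {A B} → TySet n (A ⇒ B) → TySet n A → TySet n B
  tyApp {A} S T t = Σ[ U ∈ List (ITy n A) ] (S (arr U t) × SetSub A ⟪ U ⟫ T)

-- The model D^k_A is carved out by the
-- predicate  D k A ; the order (inclusion / pointwise on D^k_A), the
-- logical relation L^k and equality in D^k are defined as in the paper.
-- L j A  is the paper's  L^(j+1)_A  (relating D^j_A and D^(j+1)_A).
-- The step function "e if d ≤ h, else ⊥" needs the (classically
-- trivial) decision of d ≤ h; it is taken from an excluded-middle oracle.

module Model {n : ℕ} (ρ : Fin n → ℕ) (em : ExcludedMiddle (lsuc 0ℓ)) where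

  open Types ρ public

  Sem : Ty → Set₁
  Sem o = Fin n → Set
  Sem (A ⇒ B) = Sem A → Sem B

  mutual
    D : ℕ → (A : Ty) → Sem A → Set₁
    D k o P = Lift (lsuc 0ℓ) (∀ q → P q → ρ q ≤ k)
    D zero (A ⇒ B) f = Mono zero A B f
    D (suc j) (A ⇒ B) f = Σ[ f₁ ∈ Sem (A ⇒ B) ] L j (A ⇒ B) f₁ f

    Le : ℕ → (A : Ty) → Sem A → Sem A → Set₁
    Le k o P R = Lift (lsuc 0ℓ) (∀ q → P q → R q)
    Le k (A ⇒ B) f g = ∀ x → D k A x → Le k B (f x) (g x)

    Mono : ℕ → (A B : Ty) → Sem (A ⇒ B) → Set₁
    Mono k A B f =
      (∀ x → D k A x → D k B (f x)) ×
      (∀ x y → D k A x → D k A y → Le k A x y → Le k B (f x) (f y))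

    L : ℕ → (A : Ty) → Sem A → Sem A → Set₁
    L j o R P = D j o R × D (suc j) o P ×
                Lift (lsuc 0ℓ) (∀ q → R q ⇔ (P q × ρ q ≤ j))
    L j (A ⇒ B) f₁ f₂ = D j (A ⇒ B) f₁ × Mono (suc j) A B f₂ ×
                        (∀ g₁ g₂ → L j A g₁ g₂ → L j B (f₁ g₁) (f₂ g₂))

  Eq : ℕ → (A : Ty) → Sem A → Sem A → Set₁
  Eq k o P R = Lift (lsuc 0ℓ) (∀ q → P q ⇔ R q)
  Eq k (A ⇒ B) f g = ∀ x → D k A x → Eq k B (f x) (g x)

  ⊥s : (A : Ty) → Sem A
  ⊥s o = λ _ → ⊥
  ⊥s (A ⇒ B) = λ _ → ⊥s B

  _⊔s_ : {A : Ty} → Sem A → Sem A → Sem A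
  _⊔s_ {o} P R = λ q → P q ⊎ R q
  _⊔s_ {A ⇒ B} f g = λ x → f x ⊔s g x

  ⋁ : {A : Ty} {I : Set} → (I → Sem A) → Sem A
  ⋁ {o} {I} f = λ q → Σ[ i ∈ I ] f i q
  ⋁ {A ⇒ B} f = λ x → ⋁ (λ i → f i x)

  step : (k : ℕ) (A B : Ty) → Sem A → Sem B → Sem (A ⇒ B)
  step k A B d e h = if does (em {Le k A d h}) then e else ⊥s B

  mutual
    ⟦_⟧ : ∀ {A} → ITy n A → ℕ → Sem A
    ⟦ base q ⟧ k = λ q′ → if ρ q ≤ᵇ k then q′ ≡ q else ⊥
    ⟦ arr {A} {B} T s ⟧ k = step k A B (⟦ T ⟧ˡ k) (⟦ s ⟧ k)

    ⟦_⟧ˡ : ∀ {A} → List (ITy n A) → ℕ → Sem A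
    ⟦_⟧ˡ {A} [] k = ⊥s A
    ⟦ t ∷ T ⟧ˡ k = ⟦ t ⟧ k ⊔s ⟦ T ⟧ˡ k

  ⟦_⟧ˢ : ∀ {A} → TySet n A → ℕ → Sem A
  ⟦_⟧ˢ {A} S k = ⋁ {A} {Σ[ t ∈ ITy n A ] S t} (λ p → ⟦ Data.Product.proj₁ p ⟧ k)

module Submission where

-- Both inequalities between ⟦S(T)⟧ and ⟦S⟧(⟦T⟧) come down to the interpretation
-- reflecting subsumption: for U, T ⊆ 𝒯^k, ⟦U⟧^k ≤ ⟦T⟧^k holds iff U ⊑ T.  Completeness is an induction on the simple type:
-- at an arrow type, ⟦V → v⟧ ≤ ⟦T⟧ is applied to the argument ⟦V⟧, which is only
-- allowed because ⟦V⟧ lies in the model D^k.  That fact carries the real work: by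
-- induction on k, (⟦t⟧^j , ⟦t⟧^(j+1)) ∈ L^(j+1) for t ∈ 𝒯^j and (⊥ , ⟦t⟧^(j+1)) ∈ L^(j+1)
-- for t ∈ τ^(j+1), the key point being that for (g₁ , g₂) ∈ L^(j+1) the conditions
-- ⟦t⟧^j ≤ g₁ and ⟦t⟧^(j+1) ≤ g₂ are equivalent.

open import Defs
open import Level using (0ℓ; lift; lower) renaming (suc to lsuc)
open import Data.Nat using (ℕ; zero; suc; _≤_; _≤ᵇ_)
open import Data.Nat.Properties using (≤ᵇ⇒≤; ≤⇒≤ᵇ; ≤-refl; ≤-trans; ≤-pred; n≤1+n; m≤n⇒m≤1+n; m≤n⇒m<n∨m≡n; 1+n≰n)
open import Data.Fin using (Fin)
open import Data.List using (List; []; _∷_)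
open import Data.List.Membership.Propositional using (_∈_)
open import Data.List.Relation.Unary.Any using (here; there)
open import Data.List.Relation.Unary.All as All using (All; []; _∷_)
open import Data.Product as Product using (Σ-syntax; _×_; _,_; proj₁; proj₂)
open import Data.Sum using (_⊎_; inj₁; inj₂)
open import Data.Empty using (⊥; ⊥-elim)
open import Data.Unit using (tt)
open import Data.Bool using (true; false; T)
open import Function.Bundles using (mk⇔; Equivalence)
open import Relation.Nullary using (yes; no; ¬_)
open import Relation.Binary.PropositionalEquality using (_≡_; refl; sym; subst)
open import Axiom.ExcludedMiddle using (ExcludedMiddle)

≤-suc-cases : ∀ {l j} → l ≤ suc j → l ≤ j ⊎ l ≡ suc j
≤-suc-cases l≤1+j with m≤n⇒m<n∨m≡n l≤1+j
... | inj₁ l<1+j = inj₁ (≤-pred l<1+j)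
... | inj₂ l≡1+j = inj₂ l≡1+j

module Semantics {n : ℕ} (ρ : Fin n → ℕ) (em : ExcludedMiddle (lsuc 0ℓ)) where

  open Model ρ em

  Le-refl : ∀ k A (a : Sem A) → Le k A a a
  Le-refl k o a = lift λ q x → x
  Le-refl k (A ⇒ B) f = λ x _ → Le-refl k B (f x)

  Le-trans : ∀ k A {a b c : Sem A} → Le k A a b → Le k A b c → Le k A a c
  Le-trans k o (lift a≤b) (lift b≤c) = lift λ q x → b≤c q (a≤b q x)
  Le-trans k (A ⇒ B) f≤g g≤h = λ x x∈D → Le-trans k B (f≤g x x∈D) (g≤h x x∈D)

  Le-antisym : ∀ k A {a b : Sem A} → Le k A a b → Le k A b a → Eq k A a b
  Le-antisym k o (lift a≤b) (lift b≤a) = lift λ q → mk⇔ (a≤b q) (b≤a q)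
  Le-antisym k (A ⇒ B) f≤g g≤f = λ x x∈D → Le-antisym k B (f≤g x x∈D) (g≤f x x∈D)

  ⊥s-least : ∀ k A (c : Sem A) → Le k A (⊥s A) c
  ⊥s-least k o c = lift λ q ()
  ⊥s-least k (A ⇒ B) f = λ x _ → ⊥s-least k B (f x)

  ⊔-upperˡ : ∀ k A (a b : Sem A) → Le k A a (_⊔s_ {A} a b)
  ⊔-upperˡ k o a b = lift λ q → inj₁
  ⊔-upperˡ k (A ⇒ B) f g = λ x _ → ⊔-upperˡ k B (f x) (g x)

  ⊔-upperʳ : ∀ k A (a b : Sem A) → Le k A b (_⊔s_ {A} a b)
  ⊔-upperʳ k o a b = lift λ q → inj₂
  ⊔-upperʳ k (A ⇒ B) f g = λ x _ → ⊔-upperʳ k B (f x) (g x)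

  ⊔-lub : ∀ k A {a b c : Sem A} → Le k A a c → Le k A b c → Le k A (_⊔s_ {A} a b) c
  ⊔-lub k o (lift a≤c) (lift b≤c) = lift λ { q (inj₁ x) → a≤c q x ; q (inj₂ x) → b≤c q x }
  ⊔-lub k (A ⇒ B) f≤h g≤h = λ x x∈D → ⊔-lub k B (f≤h x x∈D) (g≤h x x∈D)

  ⊔-mono : ∀ k A {a a′ b b′ : Sem A} → Le k A a a′ → Le k A b b′ →
           Le k A (_⊔s_ {A} a b) (_⊔s_ {A} a′ b′)
  ⊔-mono k A {a} {a′} {b} {b′} a≤a′ b≤b′ =
    ⊔-lub k A (Le-trans k A a≤a′ (⊔-upperˡ k A a′ b′)) (Le-trans k A b≤b′ (⊔-upperʳ k A a′ b′))

  ⋁-upper : ∀ k A {I : Set} (f : I → Sem A) (i : I) → Le k A (f i) (⋁ {A} f)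
  ⋁-upper k o f i = lift λ q x → i , x
  ⋁-upper k (A ⇒ B) f i = λ x _ → ⋁-upper k B (λ j → f j x) i

  ⋁-lub : ∀ k A {I : Set} (f : I → Sem A) (c : Sem A) → (∀ i → Le k A (f i) c) → Le k A (⋁ {A} f) c
  ⋁-lub k o f c f≤c = lift λ { q (i , x) → lower (f≤c i) q x }
  ⋁-lub k (A ⇒ B) f g f≤g = λ x x∈D → ⋁-lub k B (λ i → f i x) (g x) (λ i → f≤g i x x∈D)

  ∈⇒⟦⟧≤⟦⟧ˢ : ∀ k A {S : TySet n A} {t} → S t → Le k A (⟦ t ⟧ k) (⟦ S ⟧ˢ k)
  ∈⇒⟦⟧≤⟦⟧ˢ k A {t = t} t∈S = ⋁-upper k A (λ p → ⟦ proj₁ p ⟧ k) (t , t∈S)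

  ⟦⟧ˢ-lub : ∀ k A (S : TySet n A) (c : Sem A) → (∀ {t} → S t → Le k A (⟦ t ⟧ k) c) →
            Le k A (⟦ S ⟧ˢ k) c
  ⟦⟧ˢ-lub k A S c bound = ⋁-lub k A (λ p → ⟦ proj₁ p ⟧ k) c (λ (t , t∈S) → bound t∈S)

  ∈⇒⟦⟧≤⟦⟧ˡ : ∀ k A {t : ITy n A} {V} → t ∈ V → Le k A (⟦ t ⟧ k) (⟦ V ⟧ˡ k)
  ∈⇒⟦⟧≤⟦⟧ˡ k A {t} {_ ∷ V} (here refl) = ⊔-upperˡ k A (⟦ t ⟧ k) (⟦ V ⟧ˡ k)
  ∈⇒⟦⟧≤⟦⟧ˡ k A {V = u ∷ V} (there t∈V) =
    Le-trans k A (∈⇒⟦⟧≤⟦⟧ˡ k A t∈V) (⊔-upperʳ k A (⟦ u ⟧ k) (⟦ V ⟧ˡ k))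

  ⟦⟧ˡ-lub : ∀ k A V (c : Sem A) → (∀ {t} → t ∈ V → Le k A (⟦ t ⟧ k) c) → Le k A (⟦ V ⟧ˡ k) c
  ⟦⟧ˡ-lub k A [] c bound = ⊥s-least k A c
  ⟦⟧ˡ-lub k A (t ∷ V) c bound = ⊔-lub k A (bound (here refl)) (⟦⟧ˡ-lub k A V c (λ u∈V → bound (there u∈V)))

  ⟦⟧ˡ≤⟦⟧ˢ : ∀ k A V → Le k A (⟦ V ⟧ˡ k) (⟦ ⟪ V ⟫ ⟧ˢ k)
  ⟦⟧ˡ≤⟦⟧ˢ k A V = ⟦⟧ˡ-lub k A V _ (∈⇒⟦⟧≤⟦⟧ˢ k A)

  ⟦⟧ˢ≤⟦⟧ˡ : ∀ k A V → Le k A (⟦ ⟪ V ⟫ ⟧ˢ k) (⟦ V ⟧ˡ k)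
  ⟦⟧ˢ≤⟦⟧ˡ k A V = ⟦⟧ˢ-lub k A ⟪ V ⟫ _ (∈⇒⟦⟧≤⟦⟧ˡ k A)

  ⟦base⟧-elim : ∀ {k q q′} → ⟦ base q ⟧ k q′ → q′ ≡ q × ρ q ≤ k
  ⟦base⟧-elim {k} {q} q′∈ with ρ q ≤ᵇ k in ρq≤ᵇk
  ... | true = q′∈ , ≤ᵇ⇒≤ (ρ q) k (subst T (sym ρq≤ᵇk) tt)
  ... | false = ⊥-elim q′∈

  ⟦base⟧-intro : ∀ {k q} → ρ q ≤ k → ⟦ base q ⟧ k q
  ⟦base⟧-intro {k} {q} ρq≤k with ρ q ≤ᵇ k | ≤⇒≤ᵇ ρq≤k
  ... | true | _ = refl

  ⟦base⟧∈D : ∀ k q → D k o (⟦ base q ⟧ k)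
  ⟦base⟧∈D k q = lift λ q′ q′∈ → case (⟦base⟧-elim {k} {q} q′∈)
    where case : ∀ {q′} → q′ ≡ q × ρ q ≤ k → ρ q′ ≤ k
          case (refl , ρq≤k) = ρq≤k

  data StepView (k : ℕ) (A B : Ty) (d : Sem A) (e : Sem B) (x : Sem A) : Sem B → Set₁ where
    fires : Le k A d x → StepView k A B d e x e
    idle  : ¬ Le k A d x → StepView k A B d e x (⊥s B)

  step-view : ∀ k A B d e x → StepView k A B d e x (step k A B d e x)
  step-view k A B d e x with em {Le k A d x}
  ... | yes d≤x = fires d≤x
  ... | no d≰x = idle d≰x

  step-fires : ∀ k A B d e x → Le k A d x → Le k B e (step k A B d e x)
  step-fires k A B d e x d≤x with step k A B d e x | step-view k A B d e x
  ... | _ | fires _ = Le-refl k B e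
  ... | _ | idle d≰x = ⊥-elim (d≰x d≤x)

  step-self : ∀ k A B d e → Le k B e (step k A B d e d)
  step-self k A B d e = step-fires k A B d e d (Le-refl k A d)

  step-lub : ∀ k A B d e x (c : Sem B) → (Le k A d x → Le k B e c) → Le k B (step k A B d e x) c
  step-lub k A B d e x c e≤c with step k A B d e x | step-view k A B d e x
  ... | _ | fires d≤x = e≤c d≤x
  ... | _ | idle _ = ⊥s-least k B c

  mutual
    D-⊥ : ∀ k A → D k A (⊥s A)
    D-⊥ k o = lift λ q ()
    D-⊥ zero (A ⇒ B) = Mono-⊥ zero A B
    D-⊥ (suc j) (A ⇒ B) = ⊥s (A ⇒ B) , L-⊥ j (A ⇒ B)

    Mono-⊥ : ∀ k A B → Mono k A B (⊥s (A ⇒ B))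
    Mono-⊥ k A B = (λ _ _ → D-⊥ k B) , (λ _ _ _ _ _ → Le-refl k B (⊥s B))

    L-⊥ : ∀ j A → L j A (⊥s A) (⊥s A)
    L-⊥ j o = D-⊥ j o , D-⊥ (suc j) o , lift λ q → mk⇔ (λ ()) (λ ())
    L-⊥ j (A ⇒ B) = D-⊥ j (A ⇒ B) , Mono-⊥ (suc j) A B , λ _ _ _ → L-⊥ j B

  mutual
    D-⊔ : ∀ k A {a b : Sem A} → D k A a → D k A b → D k A (_⊔s_ {A} a b)
    D-⊔ k o (lift a∈D) (lift b∈D) = lift λ { q (inj₁ x) → a∈D q x ; q (inj₂ x) → b∈D q x }
    D-⊔ zero (A ⇒ B) f∈D g∈D = Mono-⊔ zero A B f∈D g∈D
    D-⊔ (suc j) (A ⇒ B) (f₁ , f₁Lf) (g₁ , g₁Lg) = _⊔s_ {A ⇒ B} f₁ g₁ , L-⊔ j (A ⇒ B) f₁Lf g₁Lg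

    Mono-⊔ : ∀ k A B {f g : Sem (A ⇒ B)} → Mono k A B f → Mono k A B g →
             Mono k A B (_⊔s_ {A ⇒ B} f g)
    Mono-⊔ k A B (f-D , f-mono) (g-D , g-mono) =
      (λ x x∈D → D-⊔ k B (f-D x x∈D) (g-D x x∈D)) ,
      (λ x y x∈D y∈D x≤y → ⊔-mono k B (f-mono x y x∈D y∈D x≤y) (g-mono x y x∈D y∈D x≤y))

    L-⊔ : ∀ j A {a₁ a₂ b₁ b₂ : Sem A} → L j A a₁ a₂ → L j A b₁ b₂ →
          L j A (_⊔s_ {A} a₁ b₁) (_⊔s_ {A} a₂ b₂)
    L-⊔ j o (a₁∈D , a₂∈D , lift a₁≈a₂) (b₁∈D , b₂∈D , lift b₁≈b₂) =
      D-⊔ j o a₁∈D b₁∈D , D-⊔ (suc j) o a₂∈D b₂∈D ,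
      lift λ q → mk⇔
        (λ { (inj₁ x) → Product.map₁ inj₁ (to (a₁≈a₂ q) x)
           ; (inj₂ x) → Product.map₁ inj₂ (to (b₁≈b₂ q) x) })
        (λ { (inj₁ x , ρq≤j) → inj₁ (from (a₁≈a₂ q) (x , ρq≤j))
           ; (inj₂ x , ρq≤j) → inj₂ (from (b₁≈b₂ q) (x , ρq≤j)) })
      where open Equivalence
    L-⊔ j (A ⇒ B) (f₁∈D , f₂-mono , f-app) (g₁∈D , g₂-mono , g-app) =
      D-⊔ j (A ⇒ B) f₁∈D g₁∈D , Mono-⊔ (suc j) A B f₂-mono g₂-mono ,
      λ x₁ x₂ x₁Lx₂ → L-⊔ j B (f-app x₁ x₂ x₁Lx₂) (g-app x₁ x₂ x₁Lx₂)

  D⇒Mono : ∀ k A B {f : Sem (A ⇒ B)} → D k (A ⇒ B) f → Mono k A B f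
  D⇒Mono zero A B f∈D = f∈D
  D⇒Mono (suc j) A B (_ , _ , f-mono , _) = f-mono

  L⇒D : ∀ j A {a₁ a₂ : Sem A} → L j A a₁ a₂ → D (suc j) A a₂
  L⇒D j o (_ , a₂∈D , _) = a₂∈D
  L⇒D j (A ⇒ B) a₁La₂ = _ , a₁La₂

  step-Mono : ∀ k A B d e → D k B e → Mono k A B (step k A B d e)
  step-Mono k A B d e e∈D = step∈D , step-mono
    where
    step∈D : ∀ x → D k A x → D k B (step k A B d e x)
    step∈D x _ with step k A B d e x | step-view k A B d e x
    ... | _ | fires _ = e∈D
    ... | _ | idle _ = D-⊥ k B

    step-mono : ∀ x y → D k A x → D k A y → Le k A x y →
                Le k B (step k A B d e x) (step k A B d e y)
    step-mono x y _ _ x≤y =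
      step-lub k A B d e x _ λ d≤x → step-fires k A B d e y (Le-trans k A d≤x x≤y)

  ⟦base⟧≤ : ∀ k q {P : Sem o} → P q → Le k o (⟦ base q ⟧ k) P
  ⟦base⟧≤ k q {P} q∈P = lift λ q′ q′∈ → subst P (sym (proj₁ (⟦base⟧-elim {k} {q} q′∈))) q∈P

  ⟦base⟧≤⇒∈ : ∀ {k q} {P : Sem o} → ρ q ≤ k → Le k o (⟦ base q ⟧ k) P → P q
  ⟦base⟧≤⇒∈ {q = q} ρq≤k (lift q≤P) = q≤P q (⟦base⟧-intro ρq≤k)

  In𝒯-rank : ∀ {k q} → In𝒯 k o (base q) → ρ q ≤ k
  In𝒯-rank {k} (l , l≤k , ρq≡l) = subst (_≤ k) (sym ρq≡l) l≤k

  In𝒯-mono : ∀ {l k} A {t : ITy n A} → l ≤ k → In𝒯 l A t → In𝒯 k A t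
  In𝒯-mono A l≤k (i , i≤l , t∈τ) = i , ≤-trans i≤l l≤k , t∈τ

  In𝒯-suc : ∀ {j A} {t : ITy n A} → In𝒯 j A t → In𝒯 (suc j) A t
  In𝒯-suc {j} {A} = In𝒯-mono A (n≤1+n j)

  In𝒯-dom : ∀ {k A B U t} → In𝒯 k (A ⇒ B) (arr U t) → All (In𝒯 k A) U
  In𝒯-dom {A = A} (l , l≤k , U∈𝒯 , _) = All.map (In𝒯-mono A l≤k) U∈𝒯

  In𝒯-cod : ∀ {k A B U t} → In𝒯 k (A ⇒ B) (arr U t) → In𝒯 k B t
  In𝒯-cod (l , l≤k , _ , t∈τ) = l , l≤k , t∈τ

  mutual
    ⟦⟧∈D : ∀ k A (t : ITy n A) → In𝒯 k A t → D k A (⟦ t ⟧ k)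
    ⟦⟧∈D k o (base q) _ = ⟦base⟧∈D k q
    ⟦⟧∈D zero (A ⇒ B) (arr V v) t∈𝒯 = step-Mono zero A B _ _ (⟦⟧∈D zero B v (In𝒯-cod t∈𝒯))
    ⟦⟧∈D (suc j) (A ⇒ B) t (l , l≤1+j , t∈τ) with ≤-suc-cases l≤1+j
    ... | inj₁ l≤j = L⇒D j (A ⇒ B) (L-⟦⟧ j (A ⇒ B) t (l , l≤j , t∈τ))
    ... | inj₂ refl = L⇒D j (A ⇒ B) (L-⊥-⟦⟧ j (A ⇒ B) t t∈τ)

    ⟦⟧ˡ∈D : ∀ k A V → All (In𝒯 k A) V → D k A (⟦ V ⟧ˡ k)
    ⟦⟧ˡ∈D k A [] [] = D-⊥ k A
    ⟦⟧ˡ∈D k A (t ∷ V) (t∈𝒯 ∷ V∈𝒯) = D-⊔ k A (⟦⟧∈D k A t t∈𝒯) (⟦⟧ˡ∈D k A V V∈𝒯)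

    L-⟦⟧ : ∀ j A (t : ITy n A) → In𝒯 j A t → L j A (⟦ t ⟧ j) (⟦ t ⟧ (suc j))
    L-⟦⟧ j o (base q) q∈𝒯 =
      ⟦base⟧∈D j q , ⟦base⟧∈D (suc j) q , lift λ q′ → mk⇔ (to q′) (from q′)
      where
      ρq≤j = In𝒯-rank q∈𝒯
      to : ∀ q′ → ⟦ base q ⟧ j q′ → ⟦ base q ⟧ (suc j) q′ × ρ q′ ≤ j
      to q′ q′∈ with ⟦base⟧-elim {j} {q} q′∈
      ... | refl , _ = ⟦base⟧-intro (m≤n⇒m≤1+n ρq≤j) , ρq≤j
      from : ∀ q′ → ⟦ base q ⟧ (suc j) q′ × ρ q′ ≤ j → ⟦ base q ⟧ j q′
      from q′ (q′∈ , _) with ⟦base⟧-elim {suc j} {q} q′∈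
      ... | refl , _ = ⟦base⟧-intro ρq≤j
    L-⟦⟧ j (A ⇒ B) (arr W w) t∈𝒯 =
      ⟦⟧∈D j (A ⇒ B) (arr W w) t∈𝒯 ,
      step-Mono (suc j) A B _ _ (⟦⟧∈D (suc j) B w (In𝒯-suc w∈𝒯)) ,
      app
      where
      W∈𝒯 = In𝒯-dom t∈𝒯
      w∈𝒯 = In𝒯-cod t∈𝒯
      app : ∀ g₁ g₂ → L j A g₁ g₂ → L j B (⟦ arr W w ⟧ j g₁) (⟦ arr W w ⟧ (suc j) g₂)
      app g₁ g₂ g₁Lg₂
        with step j A B (⟦ W ⟧ˡ j) (⟦ w ⟧ j) g₁
           | step-view j A B (⟦ W ⟧ˡ j) (⟦ w ⟧ j) g₁
           | step (suc j) A B (⟦ W ⟧ˡ (suc j)) (⟦ w ⟧ (suc j)) g₂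
           | step-view (suc j) A B (⟦ W ⟧ˡ (suc j)) (⟦ w ⟧ (suc j)) g₂
      ... | _ | fires _    | _ | fires _    = L-⟦⟧ j B w w∈𝒯
      ... | _ | fires W≤g₁ | _ | idle W≰g₂  = ⊥-elim (W≰g₂ (⟦⟧ˡ≤-lift j A W W∈𝒯 g₁Lg₂ W≤g₁))
      ... | _ | idle W≰g₁  | _ | fires W≤g₂ = ⊥-elim (W≰g₁ (⟦⟧ˡ≤-lower j A W W∈𝒯 g₁Lg₂ W≤g₂))
      ... | _ | idle _     | _ | idle _     = L-⊥ j B

    L-⟦⟧ˡ : ∀ j A V → All (In𝒯 j A) V → L j A (⟦ V ⟧ˡ j) (⟦ V ⟧ˡ (suc j))
    L-⟦⟧ˡ j A [] [] = L-⊥ j A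
    L-⟦⟧ˡ j A (t ∷ V) (t∈𝒯 ∷ V∈𝒯) = L-⊔ j A (L-⟦⟧ j A t t∈𝒯) (L-⟦⟧ˡ j A V V∈𝒯)

    L-⊥-⟦⟧ : ∀ j A (t : ITy n A) → Inτ (suc j) A t → L j A (⊥s A) (⟦ t ⟧ (suc j))
    L-⊥-⟦⟧ j o (base q) ρq≡1+j =
      D-⊥ j o , ⟦base⟧∈D (suc j) q , lift λ q′ → mk⇔ (λ ()) (rank-too-big q′)
      where
      rank-too-big : ∀ q′ → ⟦ base q ⟧ (suc j) q′ × ρ q′ ≤ j → ⊥
      rank-too-big q′ (q′∈ , ρq′≤j) with ⟦base⟧-elim {suc j} {q} q′∈
      ... | refl , _ = 1+n≰n (subst (_≤ j) ρq≡1+j ρq′≤j)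
    L-⊥-⟦⟧ j (A ⇒ B) (arr W w) (_ , w∈τ) =
      D-⊥ j (A ⇒ B) ,
      step-Mono (suc j) A B _ _ (⟦⟧∈D (suc j) B w (suc j , ≤-refl , w∈τ)) ,
      app
      where
      app : ∀ g₁ g₂ → L j A g₁ g₂ → L j B (⊥s B) (⟦ arr W w ⟧ (suc j) g₂)
      app _ g₂ _
        with step (suc j) A B (⟦ W ⟧ˡ (suc j)) (⟦ w ⟧ (suc j)) g₂
           | step-view (suc j) A B (⟦ W ⟧ˡ (suc j)) (⟦ w ⟧ (suc j)) g₂
      ... | _ | fires _ = L-⊥-⟦⟧ j B w w∈τ
      ... | _ | idle _ = L-⊥ j B

    ⟦⟧≤-lift : ∀ j A (t : ITy n A) → In𝒯 j A t → ∀ {g₁ g₂} → L j A g₁ g₂ →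
               Le j A (⟦ t ⟧ j) g₁ → Le (suc j) A (⟦ t ⟧ (suc j)) g₂
    ⟦⟧≤-lift j o (base q) q∈𝒯 (_ , _ , lift g₁≈g₂) t≤g₁ =
      ⟦base⟧≤ (suc j) q (proj₁ (Equivalence.to (g₁≈g₂ q) (⟦base⟧≤⇒∈ (In𝒯-rank q∈𝒯) t≤g₁)))
    ⟦⟧≤-lift j (A ⇒ B) (arr W w) t∈𝒯 {g₁} {g₂} (_ , (_ , g₂-mono) , g-app) t≤g₁ x x∈D =
      step-lub (suc j) A B _ _ x (g₂ x) λ W≤x →
        Le-trans (suc j) B
          (⟦⟧≤-lift j B w (In𝒯-cod t∈𝒯) (g-app _ _ (L-⟦⟧ˡ j A W W∈𝒯))
             (Le-trans j B (step-self j A B _ _) (t≤g₁ (⟦ W ⟧ˡ j) (⟦⟧ˡ∈D j A W W∈𝒯))))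
          (g₂-mono _ x (⟦⟧ˡ∈D (suc j) A W (All.map In𝒯-suc W∈𝒯)) x∈D W≤x)
      where W∈𝒯 = In𝒯-dom t∈𝒯

    ⟦⟧≤-lower : ∀ j A (t : ITy n A) → In𝒯 j A t → ∀ {g₁ g₂} → L j A g₁ g₂ →
                Le (suc j) A (⟦ t ⟧ (suc j)) g₂ → Le j A (⟦ t ⟧ j) g₁
    ⟦⟧≤-lower j o (base q) q∈𝒯 (_ , _ , lift g₁≈g₂) t≤g₂ =
      ⟦base⟧≤ j q (Equivalence.from (g₁≈g₂ q) (⟦base⟧≤⇒∈ (m≤n⇒m≤1+n ρq≤j) t≤g₂ , ρq≤j))
      where ρq≤j = In𝒯-rank q∈𝒯
    ⟦⟧≤-lower j (A ⇒ B) (arr W w) t∈𝒯 {g₁} {g₂} (g₁∈D , _ , g-app) t≤g₂ x x∈D =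
      step-lub j A B _ _ x (g₁ x) λ W≤x →
        Le-trans j B
          (⟦⟧≤-lower j B w (In𝒯-cod t∈𝒯) (g-app _ _ (L-⟦⟧ˡ j A W W∈𝒯))
             (Le-trans (suc j) B (step-self (suc j) A B _ _)
                (t≤g₂ (⟦ W ⟧ˡ (suc j)) (⟦⟧ˡ∈D (suc j) A W (All.map In𝒯-suc W∈𝒯)))))
          (proj₂ (D⇒Mono j A B g₁∈D) _ x (⟦⟧ˡ∈D j A W W∈𝒯) x∈D W≤x)
      where W∈𝒯 = In𝒯-dom t∈𝒯

    ⟦⟧ˡ≤-lift : ∀ j A V → All (In𝒯 j A) V → ∀ {g₁ g₂} → L j A g₁ g₂ →
                Le j A (⟦ V ⟧ˡ j) g₁ → Le (suc j) A (⟦ V ⟧ˡ (suc j)) g₂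
    ⟦⟧ˡ≤-lift j A [] [] _ _ = ⊥s-least (suc j) A _
    ⟦⟧ˡ≤-lift j A (t ∷ V) (t∈𝒯 ∷ V∈𝒯) g₁Lg₂ tV≤g₁ =
      ⊔-lub (suc j) A
        (⟦⟧≤-lift j A t t∈𝒯 g₁Lg₂ (Le-trans j A (⊔-upperˡ j A _ _) tV≤g₁))
        (⟦⟧ˡ≤-lift j A V V∈𝒯 g₁Lg₂ (Le-trans j A (⊔-upperʳ j A _ _) tV≤g₁))

    ⟦⟧ˡ≤-lower : ∀ j A V → All (In𝒯 j A) V → ∀ {g₁ g₂} → L j A g₁ g₂ →
                 Le (suc j) A (⟦ V ⟧ˡ (suc j)) g₂ → Le j A (⟦ V ⟧ˡ j) g₁
    ⟦⟧ˡ≤-lower j A [] [] _ _ = ⊥s-least j A _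
    ⟦⟧ˡ≤-lower j A (t ∷ V) (t∈𝒯 ∷ V∈𝒯) g₁Lg₂ tV≤g₂ =
      ⊔-lub j A
        (⟦⟧≤-lower j A t t∈𝒯 g₁Lg₂ (Le-trans (suc j) A (⊔-upperˡ (suc j) A _ _) tV≤g₂))
        (⟦⟧ˡ≤-lower j A V V∈𝒯 g₁Lg₂ (Le-trans (suc j) A (⊔-upperʳ (suc j) A _ _) tV≤g₂))

  mutual
    ⊑-sound : ∀ k A {s t : ITy n A} → TySub A s t → Le k A (⟦ s ⟧ k) (⟦ t ⟧ k)
    ⊑-sound k o refl = Le-refl k o _
    ⊑-sound k (A ⇒ B) {arr S s} {arr T t} (T⊑S , s⊑t) x _ =
      step-lub k A B _ _ x _ λ S≤x →
        Le-trans k B (⊑-sound k B s⊑t)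
          (step-fires k A B _ _ x (Le-trans k A (⊑ˡ-sound k A T⊑S) (Le-trans k A (⟦⟧ˢ≤⟦⟧ˡ k A S) S≤x)))

    ⊑ˢ-sound : ∀ k A {S T : TySet n A} → SetSub A S T → Le k A (⟦ S ⟧ˢ k) (⟦ T ⟧ˢ k)
    ⊑ˢ-sound k o {S} S⊆T = ⟦⟧ˢ-lub k o S _ λ s∈S → ∈⇒⟦⟧≤⟦⟧ˢ k o (S⊆T _ s∈S)
    ⊑ˢ-sound k (A ⇒ B) {S} S⊑T = ⟦⟧ˢ-lub k (A ⇒ B) S _ λ s∈S →
      let (t , t∈T , s⊑t) = S⊑T _ s∈S in
      Le-trans k (A ⇒ B) (⊑-sound k (A ⇒ B) s⊑t) (∈⇒⟦⟧≤⟦⟧ˢ k (A ⇒ B) t∈T)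

    ⊑ˡ-sound : ∀ k A {U : List (ITy n A)} {T : TySet n A} → SetSub A ⟪ U ⟫ T →
               Le k A (⟦ U ⟧ˡ k) (⟦ T ⟧ˢ k)
    ⊑ˡ-sound k A {U} U⊑T = Le-trans k A (⟦⟧ˡ≤⟦⟧ˢ k A U) (⊑ˢ-sound k A U⊑T)

  ⟦tyApp⟧ˢ≤⟦⟧ˢ-app : ∀ k A B {S : TySet n (A ⇒ B)} {T : TySet n A} →
                     Le k B (⟦ tyApp S T ⟧ˢ k) (⟦ S ⟧ˢ k (⟦ T ⟧ˢ k))
  ⟦tyApp⟧ˢ≤⟦⟧ˢ-app k A B {S} {T} = ⟦⟧ˢ-lub k B (tyApp S T) _ λ {t} (U , SUt , U⊑T) →
    Le-trans k B (step-fires k A B _ _ _ (⊑ˡ-sound k A U⊑T))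
      (⋁-upper k B (λ p → ⟦ proj₁ p ⟧ k (⟦ T ⟧ˢ k)) (arr U t , SUt))

  ⟦⟧ˢ-app≤⟦tyApp⟧ˢ : ∀ k A B {S : TySet n (A ⇒ B)} {T : TySet n A} (x : Sem A) →
                     (∀ {U t} → S (arr U t) → Le k A (⟦ U ⟧ˡ k) x → SetSub A ⟪ U ⟫ T) →
                     Le k B (⟦ S ⟧ˢ k x) (⟦ tyApp S T ⟧ˢ k)
  ⟦⟧ˢ-app≤⟦tyApp⟧ˢ k A B {S} {T} x U≤x⇒U⊑T =
    ⋁-lub k B (λ p → ⟦ proj₁ p ⟧ k x) _ λ where
      (arr U t , SUt) → step-lub k A B _ _ x _ λ U≤x →
        ∈⇒⟦⟧≤⟦⟧ˢ k B (U , SUt , U≤x⇒U⊑T SUt U≤x)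

  In𝒯ˢ : ℕ → (A : Ty) → TySet n A → Set
  In𝒯ˢ k A S = ∀ t → S t → In𝒯 k A t

  tyApp-In𝒯ˢ : ∀ {k A B} {S : TySet n (A ⇒ B)} {T : TySet n A} →
               In𝒯ˢ k (A ⇒ B) S → In𝒯ˢ k B (tyApp S T)
  tyApp-In𝒯ˢ S⊆𝒯 t (U , SUt , _) = In𝒯-cod (S⊆𝒯 (arr U t) SUt)

  mutual
    ⊑-complete : ∀ k A {s : ITy n A} {T : TySet n A} → In𝒯 k A s → In𝒯ˢ k A T →
                 Le k A (⟦ s ⟧ k) (⟦ T ⟧ˢ k) → Σ[ t ∈ ITy n A ] (T t × TySub A s t)
    ⊑-complete k o {base q} q∈𝒯 _ s≤T with ⟦base⟧≤⇒∈ (In𝒯-rank q∈𝒯) s≤T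
    ... | (base q′ , Tq′) , q∈⟦q′⟧ with ⟦base⟧-elim {k} {q′} q∈⟦q′⟧
    ...   | refl , _ = base q , Tq′ , refl
    ⊑-complete k (A ⇒ B) {arr V v} {T} s∈𝒯 T⊆𝒯 s≤T =
      unpack (⊑-complete k B (In𝒯-cod s∈𝒯) (tyApp-In𝒯ˢ T⊆𝒯) v≤T[V])
      where
      V∈𝒯 = In𝒯-dom s∈𝒯
      -- T(V) collects the targets of those arrows of T that fire at ⟦V⟧.
      v≤T[V] : Le k B (⟦ v ⟧ k) (⟦ tyApp T ⟪ V ⟫ ⟧ˢ k)
      v≤T[V] =
        Le-trans k B (step-self k A B _ _)
          (Le-trans k B (s≤T (⟦ V ⟧ˡ k) (⟦⟧ˡ∈D k A V V∈𝒯))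
            (⟦⟧ˢ-app≤⟦tyApp⟧ˢ k A B (⟦ V ⟧ˡ k) λ TWt W≤V →
              ⊑ˡ-complete k A (In𝒯-dom (T⊆𝒯 _ TWt)) (λ _ → All.lookup V∈𝒯)
                (Le-trans k A W≤V (⟦⟧ˡ≤⟦⟧ˢ k A V))))
      unpack : Σ[ t ∈ ITy n B ] (tyApp T ⟪ V ⟫ t × TySub B v t) →
               Σ[ t ∈ ITy n (A ⇒ B) ] (T t × TySub (A ⇒ B) (arr V v) t)
      unpack (t , (W , TWt , W⊑V) , v⊑t) = arr W t , TWt , W⊑V , v⊑t

    ⊑ˢ-complete : ∀ k A {S T : TySet n A} → In𝒯ˢ k A S → In𝒯ˢ k A T →
                  Le k A (⟦ S ⟧ˢ k) (⟦ T ⟧ˢ k) → SetSub A S T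
    ⊑ˢ-complete k o S⊆𝒯 T⊆𝒯 S≤T s s∈S
      with ⊑-complete k o (S⊆𝒯 s s∈S) T⊆𝒯 (Le-trans k o (∈⇒⟦⟧≤⟦⟧ˢ k o s∈S) S≤T)
    ... | _ , t∈T , refl = t∈T
    ⊑ˢ-complete k (A ⇒ B) S⊆𝒯 T⊆𝒯 S≤T s s∈S =
      ⊑-complete k (A ⇒ B) (S⊆𝒯 s s∈S) T⊆𝒯 (Le-trans k (A ⇒ B) (∈⇒⟦⟧≤⟦⟧ˢ k (A ⇒ B) s∈S) S≤T)

    ⊑ˡ-complete : ∀ k A {U : List (ITy n A)} {T : TySet n A} → All (In𝒯 k A) U → In𝒯ˢ k A T →
                  Le k A (⟦ U ⟧ˡ k) (⟦ T ⟧ˢ k) → SetSub A ⟪ U ⟫ T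
    ⊑ˡ-complete k A {U} U∈𝒯 T⊆𝒯 U≤T =
      ⊑ˢ-complete k A (λ _ → All.lookup U∈𝒯) T⊆𝒯 (Le-trans k A (⟦⟧ˢ≤⟦⟧ˡ k A U) U≤T)

lemma5p4 : ∀ {n} (ρ : Fin n → ℕ) (em : ExcludedMiddle (lsuc 0ℓ)) →
    let open Model ρ em in
    (k : ℕ) → k ≤ maxRank ρ → (A B : Ty) →
    (S : TySet n (A ⇒ B)) (T : TySet n A) →
    (∀ t → S t → In𝒯 k (A ⇒ B) t) → (∀ t → T t → In𝒯 k A t) →
    Eq k B (⟦ tyApp S T ⟧ˢ k) (⟦ S ⟧ˢ k (⟦ T ⟧ˢ k))
lemma5p4 ρ em k _ A B S T S⊆𝒯 T⊆𝒯 =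
  Le-antisym k B (⟦tyApp⟧ˢ≤⟦⟧ˢ-app k A B)
    (⟦⟧ˢ-app≤⟦tyApp⟧ˢ k A B (⟦ T ⟧ˢ k) λ SUt U≤T →
      ⊑ˡ-complete k A (In𝒯-dom (S⊆𝒯 _ SUt)) T⊆𝒯 U≤T)
  where open Model ρ em
        open Semantics ρ em
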